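{- For every positive integer $n$, $$\sum_{\lambda \in P_{do}(n)} (-1)^{\ell(\lambda)} = \begin{cases} (-1)^k, & \text{if } n = k^2 \text{ for some positive integer } k,\\ 0, & \text{otherwise.}\end{cases}$$
   Context: $P_{do}(n)$ denotes the set of partitions of $n$ into distinct (positive) parts whose smallest part is odd. For a partition $\lambda$, $\ell(\lambda)$ denotes its number of parts. -}

module Defs where

open import Data.Nat using (ℕ; zero; suc; _+_; _*_; _<_)
open import Data.Nat using (_%_)
open import Relation.Binary.PropositionalEquality using (_≡_)
import Data.Integer
open import Data.Integer using (ℤ; -_) renaming (_+_ to _+ℤ_; _*_ to _*ℤ_)
open import Data.List using (List; []; _∷_; length; map; foldr)
open import Data.Nat.ListAction using (sum)
open import Data.List.Relation.Unary.Linked using (Linked)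
open import Data.List.Relation.Unary.All using (All)
open import Data.List.Membership.Propositional using (_∈_)
open import Data.List.Relation.Unary.Unique.Propositional using (Unique)
open import Data.Product using (_×_)
open import Data.Unit using (⊤)
open import Function.Bundles using (_⇔_)

-- A partition is represented by its list of parts written in strictly
-- increasing order (so parts are distinct and the representation is unique).
-- The first element of the list is the smallest part.

SmallestOdd : List ℕ → Set
SmallestOdd []      = ⊤
SmallestOdd (x ∷ _) = x % 2 ≡ 1

IsPdo : ℕ → List ℕ → Set
IsPdo n λs = All (0 <_) λs × Linked _<_ λs × sum λs ≡ n × SmallestOdd λs

signPow : ℕ → ℤ
signPow zero    = Data.Integer.+_ 1
signPow (suc m) = - signPow m

List-of-partitions : Set
List-of-partitions = List (List ℕ)

signedCount : List (List ℕ) → ℤ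
signedCount = foldr (λ p acc → signPow (length p) +ℤ acc) (Data.Integer.+_ 0)

Enumerates : ℕ → List (List ℕ) → Set
Enumerates n L = Unique L × (∀ λs → (λs ∈ L) ⇔ IsPdo n λs)

-- Let F_B = Σ (-1)^ℓ(λ) q^|λ| over the partitions into distinct parts below B with odd smallest
-- part. Removing the largest part gives F_{B+1} = F_B - q^B (F_B + [B odd]). Along B = 2m + 2 this
-- recursion is solved by explicit polynomials θ m 0, which agree with Σ_{k≥1} (-1)^k q^{k²} below
-- degree 2m + 1. The key identity (1 - q^{b+2m+3}) θ m b = -q^{b+1} (1 + θ m (b + 2)) is proved by
-- induction on m for all b at once. The theorem is the coefficient of q^n in F_{2n+2}.

module Submission where

open import Defs
open import Data.Bool using (true; false; if_then_else_)
open import Data.Empty using (⊥; ⊥-elim)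
open import Data.Integer using (ℤ; +_; -_) renaming (_+_ to _+ℤ_; _-_ to _-ℤ_)
import Data.Integer.Properties as ℤ
open import Algebra.Properties.CommutativeSemigroup ℤ.+-commutativeSemigroup
  using (x∙yz≈y∙xz)
open import Data.Integer.Tactic.RingSolver using (solve-∀)
open import Data.List
  using (List; []; _∷_; [_]; _++_; _∷ʳ_; map; length; filter; initLast; _∷ʳ′_)
open import Data.List.Properties using (∷ʳ-injectiveˡ; length-++; ++-identityʳ)
open import Data.List.Membership.Propositional using (_∈_)
open import Data.List.Membership.Propositional.Properties
  using (∈-map⁺; ∈-map⁻; ∈-++⁺ˡ; ∈-++⁺ʳ; ∈-++⁻; ∈-filter⁺; ∈-filter⁻)
open import Data.List.Membership.Propositional.Properties.WithK using (unique∧set⇒bag)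
open import Data.List.Relation.Binary.BagAndSetEquality using (∼bag⇒↭)
open import Data.List.Relation.Binary.Disjoint.Propositional using (Disjoint)
open import Data.List.Relation.Binary.Permutation.Propositional as ↭ using (_↭_)
open import Data.List.Relation.Unary.All as All using (All; []; _∷_)
open import Data.List.Relation.Unary.All.Properties using (∷ʳ⁺; ∷ʳ⁻)
open import Data.List.Relation.Unary.AllPairs using ([]; _∷_)
open import Data.List.Relation.Unary.Any using (here)
open import Data.List.Relation.Unary.Linked using (Linked; []; [-]; _∷_)
open import Data.List.Relation.Unary.Linked.Properties using (Linked⇒All)
open import Data.List.Relation.Unary.Unique.Propositional using (Unique)
import Data.List.Relation.Unary.Unique.Propositional.Properties as Unique
open import Data.Nat using (ℕ; zero; suc; _+_; _*_; _≤_; _<_; _%_; s≤s; z≤n; NonZero)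
open import Data.Nat.ListAction using (sum)
open import Data.Nat.ListAction.Properties using (sum-++)
open import Data.Nat.Properties
  using ( _≟_; _<?_; +-comm; +-identityʳ; *-zeroʳ; *-suc; +-monoˡ-≤; +-cancelˡ-<
        ; m≤m+n; m≤n+m; ≤-trans; <-trans; ≤-<-trans; <-≤-trans; <-irrefl; ≮⇒≥
        ; n<1+n; m<n⇒m<1+n; m<1+n⇒m<n∨m≡n; m≤n⇒∃[o]m+o≡n)
import Data.Nat.Tactic.RingSolver as ℕ-Solver
open import Data.Product using (_×_; _,_; proj₁; proj₂; map₂)
open import Data.Sum using (inj₁; inj₂)
open import Function.Bundles using (_⇔_; mk⇔)
import Function.Properties.Equivalence as ⇔
open import Relation.Nullary using (yes; no; does)
open import Relation.Binary.PropositionalEquality hiding ([_])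

Series : Set
Series = ℕ → ℤ

0ₛ : Series
0ₛ _ = + 0

1ₛ : Series
1ₛ zero    = + 1
1ₛ (suc _) = + 0

monomial : ℤ → ℕ → Series
monomial c d n = if does (d ≟ n) then c else + 0

infixl 6 _⊕_ _⊖_
infixr 8 ⊝_ q^_·_ 1-q^_·_

_⊕_ : Series → Series → Series
(f ⊕ g) n = f n +ℤ g n

⊝_ : Series → Series
(⊝ f) n = - f n

_⊖_ : Series → Series → Series
f ⊖ g = f ⊕ ⊝ g

q^_·_ : ℕ → Series → Series
(q^ zero  · f) n       = f n
(q^ suc k · f) zero    = + 0
(q^ suc k · f) (suc n) = (q^ k · f) n

1-q^_·_ : ℕ → Series → Series
1-q^ k · f = f ⊖ q^ k · f

q^-⊕ : ∀ k f g → q^ k · (f ⊕ g) ≗ q^ k · f ⊕ q^ k · g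
q^-⊕ zero    f g n       = refl
q^-⊕ (suc k) f g zero    = refl
q^-⊕ (suc k) f g (suc n) = q^-⊕ k f g n

q^-⊝ : ∀ k f → q^ k · ⊝ f ≗ ⊝ q^ k · f
q^-⊝ zero    f n       = refl
q^-⊝ (suc k) f zero    = refl
q^-⊝ (suc k) f (suc n) = q^-⊝ k f n

q^-q^ : ∀ k l f → q^ k · q^ l · f ≗ q^ (k + l) · f
q^-q^ zero    l f n       = refl
q^-q^ (suc k) l f zero    = refl
q^-q^ (suc k) l f (suc n) = q^-q^ k l f n

q^-cong : ∀ k {f g} → f ≗ g → q^ k · f ≗ q^ k · g
q^-cong zero    f≗g n       = f≗g n
q^-cong (suc k) f≗g zero    = refl
q^-cong (suc k) f≗g (suc n) = q^-cong k f≗g n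

q^-below : ∀ k f {n} → n < k → (q^ k · f) n ≡ + 0
q^-below (suc k) f {zero}  _         = refl
q^-below (suc k) f {suc n} (s≤s n<k) = q^-below k f n<k

q^-at : ∀ k f n → (q^ k · f) (k + n) ≡ f n
q^-at zero    f n = refl
q^-at (suc k) f n = q^-at k f n

q^-0ₛ : ∀ k → q^ k · 0ₛ ≗ 0ₛ
q^-0ₛ zero    n       = refl
q^-0ₛ (suc k) zero    = refl
q^-0ₛ (suc k) (suc n) = q^-0ₛ k n

q^-monomial : ∀ k c d → q^ k · monomial c d ≗ monomial c (k + d)
q^-monomial zero    c d n       = refl
q^-monomial (suc k) c d zero    = refl
q^-monomial (suc k) c d (suc n) = q^-monomial k c d n

⊝-monomial : ∀ c d → ⊝ monomial c d ≗ monomial (- c) d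
⊝-monomial c d n with does (d ≟ n)
... | true  = refl
... | false = refl

q^-exp : ∀ {k l} f n → k ≡ l → (q^ k · f) n ≡ (q^ l · f) n
q^-exp f n refl = refl

q^-1-q^ : ∀ k e f → q^ k · 1-q^ e · f ≗ q^ k · f ⊖ q^ (k + e) · f
q^-1-q^ k e f n = begin
  (q^ k · (f ⊖ q^ e · f)) n             ≡⟨ q^-⊕ k f _ n ⟩
  (q^ k · f) n +ℤ (q^ k · ⊝ q^ e · f) n  ≡⟨ cong ((q^ k · f) n +ℤ_) (q^-⊝ k _ n) ⟩
  (q^ k · f) n -ℤ (q^ k · q^ e · f) n    ≡⟨ cong (λ z → (q^ k · f) n -ℤ z) (q^-q^ k e f n) ⟩
  (q^ k · f) n -ℤ (q^ (k + e) · f) n     ∎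
  where open ≡-Reasoning

q^-⊝q^-⊕ : ∀ k a f g → q^ k · ⊝ q^ a · (f ⊕ g) ≗ ⊝ (q^ (k + a) · f ⊕ q^ (k + a) · g)
q^-⊝q^-⊕ k a f g n = begin
  (q^ k · ⊝ q^ a · (f ⊕ g)) n            ≡⟨ q^-⊝ k _ n ⟩
  - (q^ k · q^ a · (f ⊕ g)) n            ≡⟨ cong -_ (q^-q^ k a _ n) ⟩
  - (q^ (k + a) · (f ⊕ g)) n             ≡⟨ cong -_ (q^-⊕ (k + a) f g n) ⟩
  - (q^ (k + a) · f ⊕ q^ (k + a) · g) n  ∎
  where open ≡-Reasoning

q^-1-q^-cong : ∀ k c {f h} → 1-q^ c · f ≗ h → q^ k · f ⊖ q^ (k + c) · f ≗ q^ k · h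
q^-1-q^-cong k c {f} eq n = trans (sym (q^-1-q^ k c f n)) (q^-cong k eq n)

-- θ m b = Σ_{k=1}^{m+1} (-1)^k q^{k²+bk} Π_{i=1}^{k-1} (1 - q^{2(m+1-i)}), which agrees with
-- Σ_{k≥1} (-1)^k q^{k²+bk} below degree b + 2m + 1.
θ : ℕ → ℕ → Series
θ zero    b = ⊝ q^ suc b · 1ₛ
θ (suc m) b = ⊝ q^ suc b · (1ₛ ⊕ 1-q^ 2 * suc m · θ m (2 + b))

θ-suc-shifted : ∀ m b k n → let a = k + suc b; V = θ m (2 + b) in
  (q^ k · θ (suc m) b) n ≡ - ((q^ a · 1ₛ) n +ℤ ((q^ a · V) n -ℤ (q^ (a + 2 * suc m) · V) n))
θ-suc-shifted m b k n =
  trans (q^-⊝q^-⊕ k (suc b) 1ₛ _ n)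
        (cong (λ z → - ((q^ a · 1ₛ) n +ℤ z)) (q^-1-q^ a (2 * suc m) (θ m (2 + b)) n))
  where a = k + suc b

θ-recurrence : ∀ m b → 1-q^ (suc b + 2 * suc m) · θ m b ≗ ⊝ q^ suc b · (1ₛ ⊕ θ m (2 + b))
θ-recurrence zero b n = begin
  - O a -ℤ (q^ c · ⊝ q^ a · 1ₛ) n     ≡⟨ cong (λ z → - O a -ℤ z) (q^-⊝ c _ n) ⟩
  - O a -ℤ - (q^ c · q^ a · 1ₛ) n     ≡⟨ cong (λ z → - O a -ℤ - z) (q^-q^ c a 1ₛ n) ⟩
  - O a -ℤ - O (c + a)                ≡⟨ cong (λ z → - O a -ℤ - z) (q^-exp 1ₛ n c+a≡a+a′) ⟩
  - O a -ℤ - O (a + a′)               ≡⟨ neg-distrib (O a) (O (a + a′)) ⟩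
  - (O a +ℤ - O (a + a′))             ≡⟨ cong (λ z → - (O a +ℤ - z)) (q^-q^ a a′ 1ₛ n) ⟨
  - (O a +ℤ - (q^ a · q^ a′ · 1ₛ) n)  ≡⟨ cong (λ z → - (O a +ℤ z)) (q^-⊝ a _ n) ⟨
  - (O a +ℤ (q^ a · ⊝ q^ a′ · 1ₛ) n)  ≡⟨ cong -_ (q^-⊕ a 1ₛ _ n) ⟨
  (⊝ q^ a · (1ₛ ⊕ θ zero (2 + b))) n  ∎
  where
  open ≡-Reasoning
  a = suc b
  a′ = suc (2 + b)
  c = suc b + 2 * 1
  O : ℕ → ℤ
  O k = (q^ k · 1ₛ) n
  c+a≡a+a′ : c + a ≡ a + a′
  c+a≡a+a′ = arith b
    where
    arith : ∀ b → suc b + 2 * 1 + suc b ≡ suc b + suc (2 + b)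
    arith = ℕ-Solver.solve-∀
  neg-distrib : ∀ x y → - x -ℤ - y ≡ - (x +ℤ - y)
  neg-distrib = solve-∀
-- The recurrence for b + 2 enters shifted by a and by a + e; the two terms of degree c + a
-- coming from 1ₛ cancel.
θ-recurrence (suc m) b n = begin
  θ (suc m) b n -ℤ (q^ c · θ (suc m) b) n
    ≡⟨ cong₂ _-ℤ_ (θ-suc-shifted m b 0 n) (θ-suc-shifted m b c n) ⟩
  - (O a +ℤ (V a -ℤ V (a + e))) -ℤ - (O (c + a) +ℤ (V (c + a) -ℤ V (c + a + e)))
    ≡⟨ regroup (O a) (V a) (V (a + e)) (O (c + a)) (V (c + a)) (V (c + a + e)) ⟩
  - O a -ℤ (V a -ℤ V (c + a)) +ℤ (V (a + e) -ℤ V (c + a + e)) +ℤ O (c + a)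
    ≡⟨ cong₂ (λ x y → - O a -ℤ x +ℤ y +ℤ O (c + a)) diff₁ diff₂ ⟩
  - O a -ℤ - (O (a + a′) +ℤ W (a + a′)) +ℤ - (O (c + a) +ℤ W (a + a′ + e)) +ℤ O (c + a)
    ≡⟨ cancel (O a) (O (a + a′)) (W (a + a′)) (O (c + a)) (W (a + a′ + e)) ⟩
  - (O a +ℤ - (O (a + a′) +ℤ (W (a + a′) -ℤ W (a + a′ + e))))
    ≡⟨ cong (λ z → - (O a +ℤ z)) (θ-suc-shifted m (2 + b) a n) ⟨
  - (O a +ℤ (q^ a · θ (suc m) (2 + b)) n)
    ≡⟨ cong -_ (q^-⊕ a 1ₛ _ n) ⟨
  (⊝ q^ a · (1ₛ ⊕ θ (suc m) (2 + b))) n ∎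
  where
  open ≡-Reasoning
  a = suc b
  a′ = suc (2 + b)
  e = 2 * suc m
  c = suc b + 2 * suc (suc m)
  c′ = suc (2 + b) + 2 * suc m
  O V W : ℕ → ℤ
  O k = (q^ k · 1ₛ) n
  V k = (q^ k · θ m (2 + b)) n
  W k = (q^ k · θ m (2 + (2 + b))) n
  shifted : ∀ k → V k -ℤ V (k + c′) ≡ - (O (k + a′) +ℤ W (k + a′))
  shifted k = trans (q^-1-q^-cong k c′ (θ-recurrence m (2 + b)) n) (q^-⊝q^-⊕ k a′ 1ₛ _ n)
  diff₁ : V a -ℤ V (c + a) ≡ - (O (a + a′) +ℤ W (a + a′))
  diff₁ = trans (cong (λ z → V a -ℤ z) (q^-exp _ n (arith₁ m b))) (shifted a)
    where
    arith₁ : ∀ m b → suc b + 2 * suc (suc m) + suc b ≡ suc b + (suc (2 + b) + 2 * suc m)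
    arith₁ = ℕ-Solver.solve-∀
  diff₂ : V (a + e) -ℤ V (c + a + e) ≡ - (O (c + a) +ℤ W (a + a′ + e))
  diff₂ = begin
    V (a + e) -ℤ V (c + a + e)
      ≡⟨ cong (λ z → V (a + e) -ℤ z) (q^-exp _ n (arith₂ m b)) ⟩
    V (a + e) -ℤ V (a + e + c′)
      ≡⟨ shifted (a + e) ⟩
    - (O (a + e + a′) +ℤ W (a + e + a′))
      ≡⟨ cong₂ (λ x y → - (x +ℤ y)) (q^-exp 1ₛ n (arith₃ m b)) (q^-exp _ n (arith₄ m b)) ⟩
    - (O (c + a) +ℤ W (a + a′ + e)) ∎
    where
    arith₂ : ∀ m b → suc b + 2 * suc (suc m) + suc b + 2 * suc m
                   ≡ suc b + 2 * suc m + (suc (2 + b) + 2 * suc m)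
    arith₂ = ℕ-Solver.solve-∀
    arith₃ : ∀ m b → suc b + 2 * suc m + suc (2 + b) ≡ suc b + 2 * suc (suc m) + suc b
    arith₃ = ℕ-Solver.solve-∀
    arith₄ : ∀ m b → suc b + 2 * suc m + suc (2 + b) ≡ suc b + suc (2 + b) + 2 * suc m
    arith₄ = ℕ-Solver.solve-∀
  regroup : ∀ oa va vae oca vca vcae →
    - (oa +ℤ (va -ℤ vae)) -ℤ - (oca +ℤ (vca -ℤ vcae))
      ≡ - oa -ℤ (va -ℤ vca) +ℤ (vae -ℤ vcae) +ℤ oca
  regroup = solve-∀
  cancel : ∀ oa oaa waa oca waae →
    - oa -ℤ - (oaa +ℤ waa) +ℤ - (oca +ℤ waae) +ℤ oca ≡ - (oa +ℤ - (oaa +ℤ (waa -ℤ waae)))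
  cancel = solve-∀

θ-step : ∀ m → let e = 2 * suc m; X = 1-q^ e · θ m 0 in
  θ (suc m) 0 ≗ X ⊖ q^ suc e · (X ⊕ 1ₛ)
θ-step m n = sym (begin
  (X ⊖ q^ f · (X ⊕ 1ₛ)) n
    ≡⟨ cong (λ z → X n -ℤ z) (trans (q^-⊕ f X 1ₛ n) (cong (_+ℤ O f) (q^-1-q^ f e _ n))) ⟩
  Z 0 -ℤ Z e -ℤ (Z f -ℤ Z (f + e) +ℤ O f)
    ≡⟨ regroup (Z 0) (Z e) (Z f) (Z (f + e)) (O f) ⟩
  (Z 0 -ℤ Z f) -ℤ (Z e -ℤ Z (f + e)) -ℤ O f
    ≡⟨ cong (λ z → (Z 0 -ℤ Z f) -ℤ (Z e -ℤ z) -ℤ O f) (q^-exp _ n (+-comm f e)) ⟩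
  (Z 0 -ℤ Z f) -ℤ (Z e -ℤ Z (e + f)) -ℤ O f
    ≡⟨ cong₂ (λ x y → x -ℤ y -ℤ O f) (shifted 0) (shifted e) ⟩
  - (O 1 +ℤ V 1) -ℤ - (O (e + 1) +ℤ V (e + 1)) -ℤ O f
    ≡⟨ cong₂ (λ x y → - (O 1 +ℤ V 1) -ℤ - (x +ℤ y) -ℤ O f)
             (q^-exp 1ₛ n (+-comm e 1)) (q^-exp _ n (+-comm e 1)) ⟩
  - (O 1 +ℤ V 1) -ℤ - (O f +ℤ V f) -ℤ O f
    ≡⟨ cancel (O 1) (V 1) (O f) (V f) ⟩
  - (O 1 +ℤ (V 1 -ℤ V f))
    ≡⟨ θ-suc-shifted m 0 0 n ⟨
  θ (suc m) 0 n ∎)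
  where
  open ≡-Reasoning
  e = 2 * suc m
  f = suc e
  X = 1-q^ e · θ m 0
  O V Z : ℕ → ℤ
  O k = (q^ k · 1ₛ) n
  V k = (q^ k · θ m 2) n
  Z k = (q^ k · θ m 0) n
  shifted : ∀ k → Z k -ℤ Z (k + f) ≡ - (O (k + 1) +ℤ V (k + 1))
  shifted k = trans (q^-1-q^-cong k f (θ-recurrence m 0) n) (q^-⊝q^-⊕ k 1 1ₛ _ n)
  regroup : ∀ z₀ zₑ z_f z_fe o_f →
    z₀ -ℤ zₑ -ℤ (z_f -ℤ z_fe +ℤ o_f) ≡ (z₀ -ℤ z_f) -ℤ (zₑ -ℤ z_fe) -ℤ o_f
  regroup = solve-∀
  cancel : ∀ o₁ v₁ o_f v_f → - (o₁ +ℤ v₁) -ℤ - (o_f +ℤ v_f) -ℤ o_f ≡ - (o₁ +ℤ (v₁ -ℤ v_f))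
  cancel = solve-∀

degree : ℕ → ℕ → ℕ
degree b k = k * k + b * k

degree-suc : ∀ b k → degree b (suc k) ≡ suc b + degree (2 + b) k
degree-suc = expand
  where
  expand : ∀ b k → suc k * suc k + b * suc k ≡ suc b + (k * k + (2 + b) * k)
  expand = ℕ-Solver.solve-∀

degree-one : ∀ b → degree b 1 ≡ suc b + 0
degree-one b = trans (degree-suc b 0) (cong (_+_ (suc b)) (*-zeroʳ b))

θ-below : ∀ m b {n} → n < suc b → θ m b n ≡ + 0
θ-below zero    b n<a = cong -_ (q^-below (suc b) 1ₛ n<a)
θ-below (suc m) b n<a = cong -_ (q^-below (suc b) _ n<a)

θ-suc-coeff : ∀ m b n → n < 2 * suc m → θ (suc m) b (suc b + n) ≡ - (1ₛ n +ℤ θ m (2 + b) n)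
θ-suc-coeff m b n n<e = begin
  θ (suc m) b (a + n)
    ≡⟨ θ-suc-shifted m b 0 (a + n) ⟩
  - ((q^ a · 1ₛ) (a + n) +ℤ ((q^ a · V) (a + n) -ℤ (q^ (a + e) · V) (a + n)))
    ≡⟨ cong₂ (λ x y → - (x +ℤ (y -ℤ (q^ (a + e) · V) (a + n))))
             (q^-at a 1ₛ n) (q^-at a V n) ⟩
  - (1ₛ n +ℤ (V n -ℤ (q^ (a + e) · V) (a + n)))
    ≡⟨ cong (λ z → - (1ₛ n +ℤ (V n -ℤ z))) vanishes ⟩
  - (1ₛ n +ℤ (V n -ℤ + 0))
    ≡⟨ cong (λ z → - (1ₛ n +ℤ z)) (ℤ.+-identityʳ (V n)) ⟩
  - (1ₛ n +ℤ V n) ∎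
  where
  open ≡-Reasoning
  a = suc b
  e = 2 * suc m
  V = θ m (2 + b)
  vanishes : (q^ (a + e) · V) (a + n) ≡ + 0
  vanishes = trans (sym (q^-q^ a e V (a + n))) (trans (q^-at a _ n) (q^-below e V n<e))

window-shift : ∀ m b {n} → n < 2 * suc m → n < suc (2 + b) + 2 * m
window-shift m b {n} n<e = <-≤-trans n<e (subst (_≤ suc (2 + b) + 2 * m) (sym (*-suc 2 m)) 2+2m≤3+b+2m)
  where
  2+2m≤3+b+2m : 2 + 2 * m ≤ suc (2 + b) + 2 * m
  2+2m≤3+b+2m = +-monoˡ-≤ (2 * m) {2} {suc (2 + b)} (s≤s (s≤s z≤n))

θ-square : ∀ m b k → degree b (suc k) < suc b + 2 * m → θ m b (degree b (suc k)) ≡ signPow (suc k)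
θ-square zero b k bound = ⊥-elim (<-irrefl refl (<-≤-trans bound lower))
  where
  lower : suc b + 0 ≤ degree b (suc k)
  lower = subst₂ _≤_ (sym (+-identityʳ (suc b))) (sym (degree-suc b k)) (m≤m+n (suc b) _)
θ-square (suc m) b zero _ = begin
  θ (suc m) b (degree b 1)     ≡⟨ cong (θ (suc m) b) (degree-one b) ⟩
  θ (suc m) b (suc b + 0)      ≡⟨ θ-suc-coeff m b 0 (s≤s z≤n) ⟩
  - (+ 1 +ℤ θ m (2 + b) 0)     ≡⟨ cong (λ z → - (+ 1 +ℤ z)) (θ-below m (2 + b) (s≤s z≤n)) ⟩
  - + 1                        ∎
  where open ≡-Reasoning
θ-square (suc m) b (suc k) bound = begin
  θ (suc m) b (degree b (suc (suc k))) ≡⟨ cong (θ (suc m) b) (degree-suc b (suc k)) ⟩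
  θ (suc m) b (suc b + d)              ≡⟨ θ-suc-coeff m b d d<e ⟩
  - (+ 0 +ℤ θ m (2 + b) d)             ≡⟨ cong -_ (ℤ.+-identityˡ _) ⟩
  - θ m (2 + b) d                      ≡⟨ cong -_ (θ-square m (2 + b) k (window-shift m b d<e)) ⟩
  - signPow (suc k)                    ∎
  where
  open ≡-Reasoning
  d = degree (2 + b) (suc k)
  d<e : d < 2 * suc m
  d<e = +-cancelˡ-< (suc b) d _ (subst (_< suc b + 2 * suc m) (degree-suc b (suc k)) bound)

θ-nonsquare : ∀ m b n → n < suc b + 2 * m → (∀ k → n ≢ degree b (suc k)) → θ m b n ≡ + 0
θ-nonsquare zero b n bound _ = θ-below zero b (subst (n <_) (+-identityʳ (suc b)) bound)
θ-nonsquare (suc m) b n bound ¬square with n <? suc b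
... | yes n<a = θ-below (suc m) b n<a
... | no n≮a with m≤n⇒∃[o]m+o≡n (≮⇒≥ n≮a)
...   | zero , refl = ⊥-elim (¬square 0 (sym (degree-one b)))
...   | suc d , refl = begin
  θ (suc m) b (suc b + suc d)     ≡⟨ θ-suc-coeff m b (suc d) d<e ⟩
  - (+ 0 +ℤ θ m (2 + b) (suc d))  ≡⟨ cong -_ (ℤ.+-identityˡ _) ⟩
  - θ m (2 + b) (suc d)           ≡⟨ cong -_ (θ-nonsquare m (2 + b) (suc d) d<window ¬square′) ⟩
  + 0                             ∎
  where
  open ≡-Reasoning
  d<e : suc d < 2 * suc m
  d<e = +-cancelˡ-< (suc b) (suc d) _ bound
  d<window : suc d < suc (2 + b) + 2 * m
  d<window = window-shift m b d<e
  ¬square′ : ∀ k → suc d ≢ degree (2 + b) (suc k)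
  ¬square′ k eq = ¬square (suc k) (trans (cong (_+_ (suc b)) eq) (sym (degree-suc b (suc k))))

OddHead : List ℕ → Set
OddHead []      = ⊥
OddHead (x ∷ _) = x % 2 ≡ 1

IsDo : List ℕ → Set
IsDo λs = Linked _<_ λs × OddHead λs

emptyIfOdd : ℕ → List (List ℕ)
emptyIfOdd zero          = []
emptyIfOdd (suc zero)    = [ [] ]
emptyIfOdd (suc (suc b)) = emptyIfOdd b

-- The elements of all the P_do(n) whose parts are below B: such a partition with largest
-- part B is μ ∷ʳ B with μ ∈ pdoBelow B, or [B] when B is odd.
pdoBelow : ℕ → List (List ℕ)
pdoBelow zero    = []
pdoBelow (suc B) = pdoBelow B ++ map (_∷ʳ B) (pdoBelow B ++ emptyIfOdd B)

∈-emptyIfOdd⁻ : ∀ B {μ} → μ ∈ emptyIfOdd B → μ ≡ [] × B % 2 ≡ 1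
∈-emptyIfOdd⁻ (suc zero)    (here refl) = refl , refl
∈-emptyIfOdd⁻ (suc (suc B)) μ∈          = ∈-emptyIfOdd⁻ B μ∈

∈-emptyIfOdd⁺ : ∀ B → B % 2 ≡ 1 → [] ∈ emptyIfOdd B
∈-emptyIfOdd⁺ (suc zero)    _   = here refl
∈-emptyIfOdd⁺ (suc (suc B)) odd = ∈-emptyIfOdd⁺ B odd

emptyIfOdd-unique : ∀ B → Unique (emptyIfOdd B)
emptyIfOdd-unique zero          = []
emptyIfOdd-unique (suc zero)    = [] ∷ []
emptyIfOdd-unique (suc (suc B)) = emptyIfOdd-unique B

emptyIfOdd-even : ∀ m → emptyIfOdd (2 * m) ≡ []
emptyIfOdd-even zero    = refl
emptyIfOdd-even (suc m) = trans (cong emptyIfOdd (*-suc 2 m)) (emptyIfOdd-even m)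

emptyIfOdd-odd : ∀ m → emptyIfOdd (suc (2 * m)) ≡ [ [] ]
emptyIfOdd-odd zero    = refl
emptyIfOdd-odd (suc m) = trans (cong (λ k → emptyIfOdd (suc k)) (*-suc 2 m)) (emptyIfOdd-odd m)

linked-∷ʳ⁺ : ∀ {xs x} → Linked _<_ xs → All (_< x) xs → Linked _<_ (xs ∷ʳ x)
linked-∷ʳ⁺ []          []                = [-]
linked-∷ʳ⁺ [-]         (y<x ∷ [])        = y<x ∷ [-]
linked-∷ʳ⁺ (y<z ∷ lnk) (_ ∷ z<x ∷ zs<x)  = y<z ∷ linked-∷ʳ⁺ lnk (z<x ∷ zs<x)

linked-∷ʳ⁻ : ∀ xs {x} → Linked _<_ (xs ∷ʳ x) → Linked _<_ xs × All (_< x) xs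
linked-∷ʳ⁻ []           _           = [] , []
linked-∷ʳ⁻ (y ∷ [])     (y<x ∷ _)   = [-] , y<x ∷ []
linked-∷ʳ⁻ (y ∷ z ∷ zs) (y<z ∷ lnk) with linked-∷ʳ⁻ (z ∷ zs) lnk
... | lnk′ , zs<x@(z<x ∷ _) = y<z ∷ lnk′ , <-trans y<z z<x ∷ zs<x

isDo-∷ʳ : ∀ {μ x} → IsDo μ → All (_< x) μ → IsDo (μ ∷ʳ x)
isDo-∷ʳ {_ ∷ _} (lnk , odd) μ<x = linked-∷ʳ⁺ lnk μ<x , odd

∈-pdoBelow⁻ : ∀ B {λs} → λs ∈ pdoBelow B → IsDo λs × All (_< B) λs
∈-pdoBelow⁻ (suc B) λs∈ with ∈-++⁻ (pdoBelow B) λs∈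
... | inj₁ λs∈′ = map₂ (All.map m<n⇒m<1+n) (∈-pdoBelow⁻ B λs∈′)
... | inj₂ λs∈′ with ∈-map⁻ (_∷ʳ B) λs∈′
...   | μ , μ∈ , refl with ∈-++⁻ (pdoBelow B) μ∈
...     | inj₁ μ∈′ = let isDo , μ<B = ∈-pdoBelow⁻ B μ∈′
                     in isDo-∷ʳ isDo μ<B , ∷ʳ⁺ (All.map m<n⇒m<1+n μ<B) (n<1+n B)
...     | inj₂ μ∈′ with ∈-emptyIfOdd⁻ B μ∈′
...       | refl , odd = ([-] , odd) , n<1+n B ∷ []

∈-pdoBelow⁺ : ∀ B {λs} → IsDo λs → All (_< B) λs → λs ∈ pdoBelow B
∈-pdoBelow⁺ zero {x ∷ _} _ (() ∷ _)
∈-pdoBelow⁺ (suc B) {λs} isDo λs<B with initLast λs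
∈-pdoBelow⁺ (suc B) {.[]} (_ , ()) _ | []
∈-pdoBelow⁺ (suc B) {.(μ ∷ʳ x)} (lnk , odd) λs<B | μ ∷ʳ′ x
  with linked-∷ʳ⁻ μ lnk | ∷ʳ⁻ λs<B
... | lnkμ , μ<x | _ , x<1+B with m<1+n⇒m<n∨m≡n x<1+B
...   | inj₁ x<B  =
  ∈-++⁺ˡ (∈-pdoBelow⁺ B (lnk , odd) (∷ʳ⁺ (All.map (λ y<x → <-trans y<x x<B) μ<x) x<B))
...   | inj₂ refl = ∈-++⁺ʳ (pdoBelow B) (∈-map⁺ (_∷ʳ x) (prefix μ lnkμ odd μ<x))
  where
  prefix : ∀ μ → Linked _<_ μ → OddHead (μ ∷ʳ x) → All (_< x) μ → μ ∈ pdoBelow x ++ emptyIfOdd x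
  prefix []      _    odd _   = ∈-++⁺ʳ (pdoBelow x) (∈-emptyIfOdd⁺ x odd)
  prefix (_ ∷ _) lnkμ odd μ<x = ∈-++⁺ˡ (∈-pdoBelow⁺ x (lnkμ , odd) μ<x)

pdoBelow-unique : ∀ B → Unique (pdoBelow B)
pdoBelow-unique zero    = []
pdoBelow-unique (suc B) =
  Unique.++⁺ (pdoBelow-unique B)
    (Unique.map⁺ (∷ʳ-injectiveˡ _ _)
      (Unique.++⁺ (pdoBelow-unique B) (emptyIfOdd-unique B) []∉pdoBelow))
    largest-part-differs
  where
  []∉pdoBelow : Disjoint (pdoBelow B) (emptyIfOdd B)
  []∉pdoBelow (v∈ , v∈′) with ∈-emptyIfOdd⁻ B v∈′
  ... | refl , _ with () ← proj₂ (proj₁ (∈-pdoBelow⁻ B v∈))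
  largest-part-differs : Disjoint (pdoBelow B) (map (_∷ʳ B) (pdoBelow B ++ emptyIfOdd B))
  largest-part-differs (v∈ , v∈′) with ∈-map⁻ (_∷ʳ B) v∈′
  ... | μ , _ , refl = <-irrefl refl (proj₂ (∷ʳ⁻ (proj₂ (∈-pdoBelow⁻ B v∈))))

signedMonomial : List ℕ → Series
signedMonomial μ = monomial (signPow (length μ)) (sum μ)

signedGF : List (List ℕ) → Series
signedGF []      = 0ₛ
signedGF (μ ∷ L) = signedMonomial μ ⊕ signedGF L

signedGF-++ : ∀ L M → signedGF (L ++ M) ≗ signedGF L ⊕ signedGF M
signedGF-++ []      M n = sym (ℤ.+-identityˡ _)
signedGF-++ (μ ∷ L) M n =
  trans (cong (signedMonomial μ n +ℤ_) (signedGF-++ L M n)) (sym (ℤ.+-assoc (signedMonomial μ n) _ _))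

signedMonomial-∷ʳ : ∀ μ x → signedMonomial (μ ∷ʳ x) ≗ ⊝ q^ x · signedMonomial μ
signedMonomial-∷ʳ μ x n = begin
  monomial (signPow (length (μ ∷ʳ x))) (sum (μ ∷ʳ x)) n
    ≡⟨ cong₂ (λ l s → monomial (signPow l) s n) length-∷ʳ sum-∷ʳ ⟩
  monomial (- signPow (length μ)) (x + sum μ) n
    ≡⟨ ⊝-monomial (signPow (length μ)) (x + sum μ) n ⟨
  - monomial (signPow (length μ)) (x + sum μ) n
    ≡⟨ cong -_ (q^-monomial x _ _ n) ⟨
  (⊝ q^ x · signedMonomial μ) n ∎
  where
  open ≡-Reasoning
  length-∷ʳ : length (μ ∷ʳ x) ≡ suc (length μ)
  length-∷ʳ = trans (length-++ μ) (+-comm (length μ) 1)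
  sum-∷ʳ : sum (μ ∷ʳ x) ≡ x + sum μ
  sum-∷ʳ = trans (sum-++ μ [ x ]) (trans (+-comm (sum μ) (x + 0)) (cong (_+ sum μ) (+-identityʳ x)))

signedGF-map-∷ʳ : ∀ x L → signedGF (map (_∷ʳ x) L) ≗ ⊝ q^ x · signedGF L
signedGF-map-∷ʳ x []      n = cong -_ (sym (q^-0ₛ x n))
signedGF-map-∷ʳ x (μ ∷ L) n = begin
  signedMonomial (μ ∷ʳ x) n +ℤ signedGF (map (_∷ʳ x) L) n
    ≡⟨ cong₂ _+ℤ_ (signedMonomial-∷ʳ μ x n) (signedGF-map-∷ʳ x L n) ⟩
  - (q^ x · signedMonomial μ) n +ℤ - (q^ x · signedGF L) n
    ≡⟨ ℤ.neg-distrib-+ ((q^ x · signedMonomial μ) n) ((q^ x · signedGF L) n) ⟨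
  - ((q^ x · signedMonomial μ) n +ℤ (q^ x · signedGF L) n)
    ≡⟨ cong -_ (q^-⊕ x _ _ n) ⟨
  (⊝ q^ x · signedGF (μ ∷ L)) n ∎
  where open ≡-Reasoning

signedGF-pdoBelow-suc : ∀ B →
  signedGF (pdoBelow (suc B)) ≗ signedGF (pdoBelow B) ⊖ q^ B · signedGF (pdoBelow B ++ emptyIfOdd B)
signedGF-pdoBelow-suc B n =
  trans (signedGF-++ (pdoBelow B) _ n)
        (cong (signedGF (pdoBelow B) n +ℤ_) (signedGF-map-∷ʳ B (pdoBelow B ++ emptyIfOdd B) n))

signedGF-pdoBelow : ∀ m → signedGF (pdoBelow (2 * suc m)) ≗ θ m 0
signedGF-pdoBelow zero zero                = refl
signedGF-pdoBelow zero (suc zero)          = refl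
signedGF-pdoBelow zero (suc (suc n))       = refl
signedGF-pdoBelow (suc m) n = begin
  signedGF (pdoBelow (2 * suc (suc m))) n
    ≡⟨ cong (λ B → signedGF (pdoBelow B) n) (*-suc 2 (suc m)) ⟩
  signedGF (pdoBelow (suc (suc e))) n
    ≡⟨ signedGF-pdoBelow-suc (suc e) n ⟩
  signedGF (pdoBelow (suc e)) n -ℤ (q^ suc e · signedGF (pdoBelow (suc e) ++ emptyIfOdd (suc e))) n
    ≡⟨ cong₂ (λ x y → x -ℤ y) (even-step n) (q^-cong (suc e) odd-seed n) ⟩
  (X ⊖ q^ suc e · (X ⊕ 1ₛ)) n
    ≡⟨ θ-step m n ⟨
  θ (suc m) 0 n ∎
  where
  open ≡-Reasoning
  e = 2 * suc m
  X = 1-q^ e · θ m 0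
  even-step : signedGF (pdoBelow (suc e)) ≗ X
  even-step k = begin
    signedGF (pdoBelow (suc e)) k
      ≡⟨ signedGF-pdoBelow-suc e k ⟩
    signedGF (pdoBelow e) k -ℤ (q^ e · signedGF (pdoBelow e ++ emptyIfOdd e)) k
      ≡⟨ cong (λ L → signedGF (pdoBelow e) k -ℤ (q^ e · signedGF L) k)
              (trans (cong (pdoBelow e ++_) (emptyIfOdd-even (suc m))) (++-identityʳ _)) ⟩
    signedGF (pdoBelow e) k -ℤ (q^ e · signedGF (pdoBelow e)) k
      ≡⟨ cong₂ (λ x y → x -ℤ y) (signedGF-pdoBelow m k) (q^-cong e (signedGF-pdoBelow m) k) ⟩
    X k ∎
  odd-seed : signedGF (pdoBelow (suc e) ++ emptyIfOdd (suc e)) ≗ X ⊕ 1ₛ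
  odd-seed k = begin
    signedGF (pdoBelow (suc e) ++ emptyIfOdd (suc e)) k
      ≡⟨ signedGF-++ (pdoBelow (suc e)) _ k ⟩
    signedGF (pdoBelow (suc e)) k +ℤ signedGF (emptyIfOdd (suc e)) k
      ≡⟨ cong₂ _+ℤ_ (even-step k) (cong (λ L → signedGF L k) (emptyIfOdd-odd (suc m))) ⟩
    X k +ℤ signedGF [ [] ] k
      ≡⟨ cong (X k +ℤ_) (singleton-empty k) ⟩
    (X ⊕ 1ₛ) k ∎
    where
    singleton-empty : signedGF [ [] ] ≗ 1ₛ
    singleton-empty zero    = refl
    singleton-empty (suc _) = refl

signedCount-↭ : ∀ {L M} → L ↭ M → signedCount L ≡ signedCount M
signedCount-↭ ↭.refl             = refl
signedCount-↭ (↭.prep μ L↭M)     = cong (signPow (length μ) +ℤ_) (signedCount-↭ L↭M)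
signedCount-↭ (↭.swap μ ν L↭M)   =
  trans (cong (λ z → signPow (length μ) +ℤ (signPow (length ν) +ℤ z)) (signedCount-↭ L↭M))
        (x∙yz≈y∙xz (signPow (length μ)) (signPow (length ν)) _)
signedCount-↭ (↭.trans L↭K K↭M)  = trans (signedCount-↭ L↭K) (signedCount-↭ K↭M)

signedCount-filter : ∀ n L → signedCount (filter (λ μ → sum μ ≟ n) L) ≡ signedGF L n
signedCount-filter n []      = refl
signedCount-filter n (μ ∷ L) with does (sum μ ≟ n)
... | true  = cong (signPow (length μ) +ℤ_) (signedCount-filter n L)
... | false = trans (signedCount-filter n L) (sym (ℤ.+-identityˡ _))

parts≤sum : ∀ xs → All (_≤ sum xs) xs
parts≤sum []       = []
parts≤sum (x ∷ xs) = m≤m+n x (sum xs) ∷ All.map (λ y≤ → ≤-trans y≤ (m≤n+m (sum xs) x)) (parts≤sum xs)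

odd⇒positive : ∀ {x} → x % 2 ≡ 1 → 0 < x
odd⇒positive {suc x} _ = s≤s z≤n

isDo⇒positive : ∀ {λs} → IsDo λs → All (0 <_) λs
isDo⇒positive {x ∷ _} (lnk , odd) = Linked⇒All <-trans (odd⇒positive odd) lnk

-- The parts of a partition of n lie below 2n + 2, and θ n 0 has the right coefficients
-- below degree 2n + 1.
pdoOf : ℕ → List (List ℕ)
pdoOf n = filter (λ μ → sum μ ≟ n) (pdoBelow (2 * suc n))

pdoOf-unique : ∀ n → Unique (pdoOf n)
pdoOf-unique n = Unique.filter⁺ (λ μ → sum μ ≟ n) (pdoBelow-unique (2 * suc n))

∈-pdoOf⇔ : ∀ n {λs} → λs ∈ pdoOf (suc n) ⇔ IsPdo (suc n) λs
∈-pdoOf⇔ n {λs} = mk⇔ to from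
  where
  B = 2 * suc (suc n)
  to : λs ∈ pdoOf (suc n) → IsPdo (suc n) λs
  to λs∈ with ∈-filter⁻ (λ μ → sum μ ≟ suc n) {xs = pdoBelow B} λs∈
  ... | λs∈′ , sum≡ with ∈-pdoBelow⁻ B λs∈′
  ...   | isDo@(lnk , odd) , _ = isDo⇒positive isDo , lnk , sum≡ , oddHead⇒smallestOdd odd
    where
    oddHead⇒smallestOdd : ∀ {λs} → OddHead λs → SmallestOdd λs
    oddHead⇒smallestOdd {_ ∷ _} odd = odd
  from : IsPdo (suc n) λs → λs ∈ pdoOf (suc n)
  from (_ , lnk , sum≡ , odd) =
    ∈-filter⁺ (λ μ → sum μ ≟ suc n) (∈-pdoBelow⁺ B (lnk , oddHead sum≡ odd) bounded) sum≡
    where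
    oddHead : ∀ {λs} → sum λs ≡ suc n → SmallestOdd λs → OddHead λs
    oddHead {_ ∷ _} _ odd = odd
    sum<B : sum λs < B
    sum<B = subst (_< B) (sym sum≡) (s≤s (m≤m+n (suc n) _))
    bounded : All (_< B) λs
    bounded = All.map (λ x≤sum → ≤-<-trans x≤sum sum<B) (parts≤sum λs)

signedCount-pdoOf : ∀ n → signedCount (pdoOf n) ≡ θ n 0 n
signedCount-pdoOf n = trans (signedCount-filter n (pdoBelow (2 * suc n))) (signedGF-pdoBelow n n)

theorem3p1 : (n : ℕ) → .{{_ : NonZero n}} → (L : List-of-partitions) → Enumerates n L →
    ((k : ℕ) → NonZero k → n ≡ k * k → signedCount L ≡ signPow k)
      × (((k : ℕ) → NonZero k → n ≢ k * k) → signedCount L ≡ + 0)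
theorem3p1 (suc n) L (L-unique , ∈L⇔) = square , nonsquare
  where
  N = suc n
  L↭pdoOf : L ↭ pdoOf N
  L↭pdoOf = ∼bag⇒↭ (unique∧set⇒bag L-unique (pdoOf-unique N) (⇔.trans (∈L⇔ _) (⇔.sym (∈-pdoOf⇔ n))))
  count : signedCount L ≡ θ N 0 N
  count = trans (signedCount-↭ L↭pdoOf) (signedCount-pdoOf N)
  window : N < suc 0 + 2 * N
  window = s≤s (m≤m+n N _)
  square : (k : ℕ) → NonZero k → N ≡ k * k → signedCount L ≡ signPow k
  square (suc k) _ N≡k² =
    trans count (trans (cong (θ N 0) N≡d) (θ-square N 0 k (subst (_< suc 0 + 2 * N) N≡d window)))
    where
    N≡d : N ≡ degree 0 (suc k)
    N≡d = trans N≡k² (sym (+-identityʳ _))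
  nonsquare : ((k : ℕ) → NonZero k → N ≢ k * k) → signedCount L ≡ + 0
  nonsquare ¬square =
    trans count (θ-nonsquare N 0 N window (λ k eq → ¬square (suc k) _ (trans eq (+-identityʳ _))))
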